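{- Let $\psi(f,g,h,u,v,w)=f(v-w)+g(w-u)+h(u-v)$. For arbitrary parameters $p,q,r,a,b,c$, define \[ \begin{aligned} x_1&=\psi(p,q,r,a,b,c), & x_2&=\psi(p,q,r,b,c,a), & x_3&=\psi(p,q,r,c,a,b),\\ y_1&=\psi(p,q,r,a,c,b), & y_2&=\psi(p,q,r,c,b,a), & y_3&=\psi(p,q,r,b,a,c). \end{aligned} \] Then \[ x_1^j+x_2^j+x_3^j=y_1^j+y_2^j+y_3^j \quad\text{for } j=1,2,4. \]
   Context: Parameters $p,q,r,a,b,c$ are arbitrary integers (or rationals). -}

module Defs where

open import Data.Nat using (ℕ)
open import Data.Integer using (ℤ; _+_; _-_; _*_; _^_)

ψ : ℤ → ℤ → ℤ → ℤ → ℤ → ℤ → ℤ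
ψ f g h u v w = f * (v - w) + g * (w - u) + h * (u - v)

{-# OPTIONS --safe #-}
module Submission where

open import Defs
open import Data.Nat using (ℕ)
open import Data.Integer using (ℤ; +_; 0ℤ; _+_; _*_; -_; _^_)
open import Data.Integer.Properties using (+-0-abelianGroup; *-cancelˡ-≡)
open import Data.Integer.Solver using (module +-*-Solver)
open import Data.Sum using (_⊎_; inj₁; inj₂)
open import Relation.Binary.PropositionalEquality using (_≡_; refl; sym; trans; cong; subst; module ≡-Reasoning)
open import Algebra.Properties.AbelianGroup +-0-abelianGroup using (inverseʳ-unique)
open +-*-Solver using (Polynomial; con; solve; _:+_; _:-_; _:*_; _:^_; :-_; _:=_)

-- Each side of the theorem is a power sum of ψ over the three cyclic rotations of
-- (u, v, w): the x's rotate (a, b, c) and the y's rotate (a, c, b). The rotations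
-- sum to 0, so both power sums vanish for j = 1, and for a zero-sum triple
-- Newton's identities give 2 p₄ = p₂², reducing j = 4 to j = 2, which is a
-- direct polynomial identity.

powerSum : ℕ → ℤ → ℤ → ℤ → ℤ
powerSum j x y z = x ^ j + y ^ j + z ^ j

powerSum₁ : ∀ x y z → powerSum 1 x y z ≡ x + y + z
powerSum₁ = solve 3 (λ x y z → x :^ 1 :+ y :^ 1 :+ z :^ 1 := x :+ y :+ z) refl

zeroSum⇒2*powerSum₄≡powerSum₂² : ∀ x y z → x + y + z ≡ 0ℤ →
                                 + 2 * powerSum 4 x y z ≡ powerSum 2 x y z ^ 2
zeroSum⇒2*powerSum₄≡powerSum₂² x y z x+y+z≡0 =
  subst (λ t → + 2 * powerSum 4 x y t ≡ powerSum 2 x y t ^ 2)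
        (sym (inverseʳ-unique (x + y) z x+y+z≡0))
        (newton x y)
  where
  newton : ∀ x y → + 2 * powerSum 4 x y (- (x + y)) ≡ powerSum 2 x y (- (x + y)) ^ 2
  newton = solve 2 (λ x y → let z = :- (x :+ y) in
    con (+ 2) :* (x :^ 4 :+ y :^ 4 :+ z :^ 4) := (x :^ 2 :+ y :^ 2 :+ z :^ 2) :^ 2) refl

:ψ : ∀ {n} (f g h u v w : Polynomial n) → Polynomial n
:ψ f g h u v w = f :* (v :- w) :+ g :* (w :- u) :+ h :* (u :- v)

ψ-rotations : ℕ → (p q r u v w : ℤ) → ℤ
ψ-rotations j p q r u v w = powerSum j (ψ p q r u v w) (ψ p q r v w u) (ψ p q r w u v)

ψ-rotations-sum : ∀ p q r u v w → ψ p q r u v w + ψ p q r v w u + ψ p q r w u v ≡ 0ℤ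
ψ-rotations-sum = solve 6 (λ p q r u v w → let s = :ψ p q r in
  s u v w :+ s v w u :+ s w u v := con 0ℤ) refl

ψ-rotations₁≡0 : ∀ p q r u v w → ψ-rotations 1 p q r u v w ≡ 0ℤ
ψ-rotations₁≡0 p q r u v w =
  trans (powerSum₁ (ψ p q r u v w) (ψ p q r v w u) (ψ p q r w u v)) (ψ-rotations-sum p q r u v w)

ψ-rotations₂-swap : ∀ p q r u v w → ψ-rotations 2 p q r u v w ≡ ψ-rotations 2 p q r u w v
ψ-rotations₂-swap = solve 6 (λ p q r u v w → let s = :ψ p q r in
  s u v w :^ 2 :+ s v w u :^ 2 :+ s w u v :^ 2 := s u w v :^ 2 :+ s w v u :^ 2 :+ s v u w :^ 2) refl

2*ψ-rotations₄≡ψ-rotations₂² : ∀ p q r u v w →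
                               + 2 * ψ-rotations 4 p q r u v w ≡ ψ-rotations 2 p q r u v w ^ 2
2*ψ-rotations₄≡ψ-rotations₂² p q r u v w =
  zeroSum⇒2*powerSum₄≡powerSum₂² (ψ p q r u v w) (ψ p q r v w u) (ψ p q r w u v)
                                 (ψ-rotations-sum p q r u v w)

ψ-rotations₄-swap : ∀ p q r u v w → ψ-rotations 4 p q r u v w ≡ ψ-rotations 4 p q r u w v
ψ-rotations₄-swap p q r u v w =
  *-cancelˡ-≡ (+ 2) (ψ-rotations 4 p q r u v w) (ψ-rotations 4 p q r u w v) (begin
    + 2 * ψ-rotations 4 p q r u v w  ≡⟨ 2*ψ-rotations₄≡ψ-rotations₂² p q r u v w ⟩
    ψ-rotations 2 p q r u v w ^ 2    ≡⟨ cong (_^ 2) (ψ-rotations₂-swap p q r u v w) ⟩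
    ψ-rotations 2 p q r u w v ^ 2    ≡⟨ 2*ψ-rotations₄≡ψ-rotations₂² p q r u w v ⟨
    + 2 * ψ-rotations 4 p q r u w v  ∎)
  where open ≡-Reasoning

theorem4 : (p q r a b c : ℤ) →
    let x₁ = ψ p q r a b c
        x₂ = ψ p q r b c a
        x₃ = ψ p q r c a b
        y₁ = ψ p q r a c b
        y₂ = ψ p q r c b a
        y₃ = ψ p q r b a c
    in (j : ℕ) → (j ≡ 1) ⊎ (j ≡ 2) ⊎ (j ≡ 4) →
       x₁ ^ j + x₂ ^ j + x₃ ^ j ≡ y₁ ^ j + y₂ ^ j + y₃ ^ j
theorem4 p q r a b c .1 (inj₁ refl) =
  trans (ψ-rotations₁≡0 p q r a b c) (sym (ψ-rotations₁≡0 p q r a c b))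
theorem4 p q r a b c .2 (inj₂ (inj₁ refl)) = ψ-rotations₂-swap p q r a b c
theorem4 p q r a b c .4 (inj₂ (inj₂ refl)) = ψ-rotations₄-swap p q r a b c
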